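{- Let $(T,T')\in\mathcal{T}_n\times\mathcal{T}_n$. Then $T\le T'$ in the Tamari order if and only if there is no flawed pair, i.e. no pair of nodes $v$ of $T$ and $v'$ of $T'$ such that $x'_\ell<x_\ell\le x'_r<x_r$, where $x_\ell,x_r$ (resp. $x'_\ell,x'_r$) are the indices of the leftmost and rightmost leaves of the subtree of $T$ rooted at $v$ (resp. of $T'$ rooted at $v'$).
   Context: A binary tree is either a single leaf or a node with an ordered pair (left, right) of binary subtrees; its size is its number of nodes and $\mathcal{T}_n$ is the set of binary trees of size $n$. The Tamari order $\le$ on $\mathcal{T}_n$ is the reflexive-transitive closure of the relation in which $T'$ is obtained from $T$ by replacing some subtree of the form $((A,B),C)$ by $(A,(B,C))$. In each tree of $\mathcal{T}_n$ the $n+1$ leaves are indexed $0,1,\dots,n$ from left to right. -}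

module Defs where

open import Data.Nat using (ℕ; zero; suc; _+_; _<_; _≤_)
open import Data.Product using (Σ; _×_; _,_; ∃)
open import Relation.Binary.PropositionalEquality using (_≡_)
open import Relation.Binary.Construct.Closure.ReflexiveTransitive using (Star)

data BTree : Set where
  leaf : BTree
  node : BTree → BTree → BTree

size : BTree → ℕ
size leaf = 0
size (node l r) = suc (size l + size r)

𝒯 : ℕ → Set
𝒯 n = Σ BTree (λ t → size t ≡ n)

data Rot : BTree → BTree → Set where
  rot-here : ∀ A B C → Rot (node (node A B) C) (node A (node B C))
  rot-left : ∀ {l l'} r → Rot l l' → Rot (node l r) (node l' r)
  rot-right : ∀ l {r r'} → Rot r r' → Rot (node l r) (node l r')

_≤T_ : BTree → BTree → Set
T ≤T T' = Star Rot T T'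

data Node : BTree → Set where
  here : ∀ {l r} → Node (node l r)
  inl  : ∀ {l r} → Node l → Node (node l r)
  inr  : ∀ {l r} → Node r → Node (node l r)

-- Leaves of a tree are indexed 0,1,…,size from left to right.
-- For a subtree starting at leaf offset o, `leftLeafFrom o t v` / `rightLeafFrom o t v`
-- are the indices of the leftmost / rightmost leaves of the subtree rooted at v.
leftLeafFrom : ℕ → (t : BTree) → Node t → ℕ
leftLeafFrom o (node l r) here = o
leftLeafFrom o (node l r) (inl v) = leftLeafFrom o l v
leftLeafFrom o (node l r) (inr v) = leftLeafFrom (o + suc (size l)) r v

rightLeafFrom : ℕ → (t : BTree) → Node t → ℕ
rightLeafFrom o (node l r) here = o + size (node l r)
rightLeafFrom o (node l r) (inl v) = rightLeafFrom o l v
rightLeafFrom o (node l r) (inr v) = rightLeafFrom (o + suc (size l)) r v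

xl : (t : BTree) → Node t → ℕ
xl = leftLeafFrom 0

xr : (t : BTree) → Node t → ℕ
xr = rightLeafFrom 0

FlawedPair : BTree → BTree → Set
FlawedPair T T' = Σ (Node T) λ v → Σ (Node T') λ v' →
  (xl T' v' < xl T v) × (xl T v ≤ xr T' v') × (xr T' v' < xr T v)

module Submission where

open import Defs
open import Data.Empty using (⊥-elim)
open import Data.Nat
open import Data.Nat.Properties
open import Data.Nat.Tactic.RingSolver using (solve-∀)
open import Data.Product using (Σ; _×_; _,_; proj₁)
open import Data.Sum using (_⊎_; inj₁; inj₂)
open import Function.Bundles using (_⇔_; mk⇔)
open import Relation.Binary.Construct.Closure.ReflexiveTransitive using (ε; _◅_; _◅◅_; gmap)
open import Relation.Binary.Definitions using (tri<; tri≈; tri>)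
open import Relation.Binary.PropositionalEquality
open import Relation.Nullary using (¬_)

-- Every node v spans the leaf interval [x_ℓ(v), x_r(v)].  A rotation keeps the left
-- end of every span and can only move its right end to the right, and the spans of
-- a single tree are laminar; hence a flawed pair can never arise along a chain of
-- rotations.  Conversely, let T' = (L', R') with |L'| = k.  Having no flawed pair
-- against the left child of T' means no span of T straddles leaf k; then rotating
-- along the left spine of T reaches a tree (X, R) with |X| = k whose spans all come
-- from spans of T, and one recurses into (X, L') and (R, R').

span : ℕ → (t : BTree) → Node t → ℕ × ℕ
span o t v = leftLeafFrom o t v , rightLeafFrom o t v

-- FlawedPair T T' is, definitionally, a pair of nodes with Crossing (span 0 T v) (span 0 T' v').
Crossing : ℕ × ℕ → ℕ × ℕ → Set
Crossing (a , b) (a' , b') = a' < a × a ≤ b' × b' < b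

Flawless : ℕ → BTree → BTree → Set
Flawless o t t' = ∀ v v' → ¬ Crossing (span o t v) (span o t' v')

IsSpan : ℕ → (t : BTree) → ℕ × ℕ → Set
IsSpan o t I = Σ (Node t) λ v → span o t v ≡ I

_⊑_ : ℕ × ℕ → ℕ × ℕ → Set
(a , b) ⊑ (a₁ , b₁) = a ≡ a₁ × b ≤ b₁

⊑-reflexive : ∀ {I J} → I ≡ J → I ⊑ J
⊑-reflexive refl = refl , ≤-refl

Crossing-⊑ : ∀ {I I₁} J → I ⊑ I₁ → Crossing I J → Crossing I₁ J
Crossing-⊑ J (refl , b≤b₁) (a'<a , a≤b' , b'<b) = a'<a , a≤b' , <-≤-trans b'<b b≤b₁

Crossing-≡ : ∀ {I I₁} J → I ≡ I₁ → Crossing I J → Crossing I₁ J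
Crossing-≡ J e = Crossing-⊑ J (⊑-reflexive e)

offset≤leftLeafFrom : ∀ o t (v : Node t) → o ≤ leftLeafFrom o t v
offset≤leftLeafFrom o (node l r) here    = ≤-refl
offset≤leftLeafFrom o (node l r) (inl v) = offset≤leftLeafFrom o l v
offset≤leftLeafFrom o (node l r) (inr v) =
  ≤-trans (m≤m+n o (suc (size l))) (offset≤leftLeafFrom _ r v)

rightLeafFrom≤offset+size : ∀ o t (v : Node t) → rightLeafFrom o t v ≤ o + size t
rightLeafFrom≤offset+size o (node l r) here    = ≤-refl
rightLeafFrom≤offset+size o (node l r) (inl v) =
  ≤-trans (rightLeafFrom≤offset+size o l v) (+-monoʳ-≤ o (m≤n⇒m≤1+n (m≤m+n (size l) (size r))))
rightLeafFrom≤offset+size o (node l r) (inr v) =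
  ≤-trans (rightLeafFrom≤offset+size _ r v) (≤-reflexive (+-assoc o (suc (size l)) (size r)))

leftLeafFrom≤rightLeafFrom : ∀ o t (v : Node t) → leftLeafFrom o t v ≤ rightLeafFrom o t v
leftLeafFrom≤rightLeafFrom o (node l r) here    = m≤m+n o _
leftLeafFrom≤rightLeafFrom o (node l r) (inl v) = leftLeafFrom≤rightLeafFrom o l v
leftLeafFrom≤rightLeafFrom o (node l r) (inr v) = leftLeafFrom≤rightLeafFrom _ r v

leftSpan<rightSpan : ∀ o l r (v : Node l) (w : Node r) →
  rightLeafFrom o l v < leftLeafFrom (o + suc (size l)) r w
leftSpan<rightSpan o l r v w = begin-strict
  rightLeafFrom o l v             ≤⟨ rightLeafFrom≤offset+size o l v ⟩
  o + size l                      <⟨ +-monoʳ-< o (n<1+n (size l)) ⟩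
  o + suc (size l)                ≤⟨ offset≤leftLeafFrom _ r w ⟩
  leftLeafFrom (o + suc (size l)) r w ∎
  where open ≤-Reasoning

¬Crossing-offset : ∀ o b t (v : Node t) → ¬ Crossing (o , b) (span o t v)
¬Crossing-offset o b t v (a'<o , _) = <⇒≱ a'<o (offset≤leftLeafFrom o t v)

¬Crossing-end : ∀ o a' t (v : Node t) → ¬ Crossing (span o t v) (a' , o + size t)
¬Crossing-end o a' t v (_ , _ , end<b) = <⇒≱ end<b (rightLeafFrom≤offset+size o t v)

spans-laminar : ∀ o t (v w : Node t) → ¬ Crossing (span o t v) (span o t w)
spans-laminar o t@(node l r) here w          = ¬Crossing-offset o _ t w
spans-laminar o t@(node l r) v here          = ¬Crossing-end o o t v
spans-laminar o (node l r) (inl v) (inl w)   = spans-laminar o l v w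
spans-laminar o (node l r) (inr v) (inr w)   = spans-laminar _ r v w
spans-laminar o (node l r) (inl v) (inr w) (a'<a , _) =
  <⇒≱ a'<a (≤-trans (leftLeafFrom≤rightLeafFrom o l v) (<⇒≤ (leftSpan<rightSpan o l r v w)))
spans-laminar o (node l r) (inr v) (inl w) (_ , a≤b' , _) =
  <⇒≱ (leftSpan<rightSpan o l r w v) a≤b'

Rot-size : ∀ {t t₁} → Rot t t₁ → size t ≡ size t₁
Rot-size (rot-here A B C) = cong suc (trans (cong suc (+-assoc (size A) (size B) (size C))) (sym (+-suc (size A) _)))
Rot-size (rot-left r ρ)   = cong (λ x → suc (x + size r)) (Rot-size ρ)
Rot-size (rot-right l ρ)  = cong (λ x → suc (size l + x)) (Rot-size ρ)

≤T-size : ∀ {t t'} → t ≤T t' → size t ≡ size t'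
≤T-size ε       = refl
≤T-size (ρ ◅ s) = trans (Rot-size ρ) (≤T-size s)

rotated-offset : ∀ o a b → (o + suc a) + suc b ≡ o + suc (suc (a + b))
rotated-offset = solve-∀

Rot-extends : ∀ {t t₁} → Rot t t₁ → ∀ o (v : Node t) → Σ (Node t₁) λ v₁ → span o t v ⊑ span o t₁ v₁
Rot-extends ρ@(rot-here A B C) o here = here , refl , ≤-reflexive (cong (o +_) (Rot-size ρ))
Rot-extends ρ@(rot-left r _)   o here = here , refl , ≤-reflexive (cong (o +_) (Rot-size ρ))
Rot-extends ρ@(rot-right l _)  o here = here , refl , ≤-reflexive (cong (o +_) (Rot-size ρ))
Rot-extends (rot-here A B C) o (inl here) =
  here , refl , +-monoʳ-≤ o (s≤s (+-monoʳ-≤ (size A) (m≤n⇒m≤1+n (m≤m+n (size B) (size C)))))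
Rot-extends (rot-here A B C) o (inl (inl w)) = inl w , ⊑-reflexive refl
Rot-extends (rot-here A B C) o (inl (inr w)) = inr (inl w) , ⊑-reflexive refl
Rot-extends (rot-here A B C) o (inr w) =
  inr (inr w) , ⊑-reflexive (cong (λ p → span p C w) (sym (rotated-offset o (size A) (size B))))
Rot-extends (rot-left r ρ) o (inl v) with Rot-extends ρ o v
... | v₁ , ext = inl v₁ , ext
Rot-extends (rot-left r ρ) o (inr v) =
  inr v , ⊑-reflexive (cong (λ s → span (o + suc s) r v) (Rot-size ρ))
Rot-extends (rot-right l ρ) o (inl v) = inl v , ⊑-reflexive refl
Rot-extends (rot-right l ρ) o (inr v) with Rot-extends ρ (o + suc (size l)) v
... | v₁ , ext = inr v₁ , ext

Flawless-Rot : ∀ {o t t₁ t'} → Rot t t₁ → Flawless o t₁ t' → Flawless o t t'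
Flawless-Rot {o} {t' = t'} ρ fl v v' c with Rot-extends ρ o v
... | v₁ , ext = fl v₁ v' (Crossing-⊑ (span o t' v') ext c)

≤T⇒Flawless : ∀ o {t t'} → t ≤T t' → Flawless o t t'
≤T⇒Flawless o ε       = spans-laminar o _
≤T⇒Flawless o (ρ ◅ s) = Flawless-Rot ρ (≤T⇒Flawless o s)

≤T-nodeˡ : ∀ {t t'} r → t ≤T t' → node t r ≤T node t' r
≤T-nodeˡ r = gmap (λ t → node t r) (rot-left r)

≤T-nodeʳ : ∀ {t t'} l → t ≤T t' → node l t ≤T node l t'
≤T-nodeʳ l = gmap (node l) (rot-right l)

-- The rotations create new spans only at the first leaf of the right part; those can
-- never cross a span of a tree with the same offset (see ¬Crossing-offset).
record SplitAt (k o : ℕ) (t : BTree) : Set where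
  constructor mkSplitAt
  field
    left right  : BTree
    t≤node      : t ≤T node left right
    size-left   : size left ≡ k
    left-spans  : ∀ v → IsSpan o t (span o left v)
    right-spans : ∀ v → leftLeafFrom (o + suc k) right v ≡ o + suc k
                      ⊎ IsSpan o t (span (o + suc k) right v)

Straddles : ℕ → ℕ → BTree → Set
Straddles k o t = Σ (Node t) λ v → Crossing (span o t v) (o , o + k)

rightChild-straddles : ∀ k o l r → size l < k → k < size (node l r) → Straddles k o (node l r)
rightChild-straddles k o l leaf l<k k<size =
  ⊥-elim (<⇒≱ l<k (subst (k ≤_) (+-identityʳ (size l)) (≤-pred k<size)))
rightChild-straddles k o l r@(node _ _) l<k k<size =
  inr here , m<m+n o (s≤s z≤n) , +-monoʳ-≤ o l<k ,
  subst (o + k <_) (sym (+-assoc o (suc (size l)) (size r))) (+-monoʳ-< o k<size)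

splitAt-rotate : ∀ k o l r → SplitAt k o l → SplitAt k o (node l r)
splitAt-rotate k o l r (mkSplitAt X R₀ l≤XR₀ refl X-spans R₀-spans) =
  mkSplitAt X (node R₀ r) l≤X[R₀r] refl X-spans' R₀r-spans
  where
  l≤X[R₀r] : node l r ≤T node X (node R₀ r)
  l≤X[R₀r] = ≤T-nodeˡ r l≤XR₀ ◅◅ (rot-here X R₀ r ◅ ε)

  r-offset : o + suc (size l) ≡ (o + suc (size X)) + suc (size R₀)
  r-offset = begin
    o + suc (size l)                         ≡⟨ cong (λ s → o + suc s) (≤T-size l≤XR₀) ⟩
    o + suc (suc (size X + size R₀))         ≡⟨ sym (rotated-offset o (size X) (size R₀)) ⟩
    (o + suc (size X)) + suc (size R₀)       ∎
    where open ≡-Reasoning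

  X-spans' : ∀ v → IsSpan o (node l r) (span o X v)
  X-spans' v with X-spans v
  ... | w , e = inl w , e

  R₀r-spans : ∀ v → leftLeafFrom (o + suc (size X)) (node R₀ r) v ≡ o + suc (size X)
                  ⊎ IsSpan o (node l r) (span (o + suc (size X)) (node R₀ r) v)
  R₀r-spans here = inj₁ refl
  R₀r-spans (inl v) with R₀-spans v
  ... | inj₁ e       = inj₁ e
  ... | inj₂ (w , e) = inj₂ (inl w , e)
  R₀r-spans (inr v) = inj₂ (inr v , cong (λ p → span p r v) r-offset)

split : ∀ k o t → k < size t → ¬ Straddles k o t → SplitAt k o t
split k o (node l r) k<size ¬straddle with <-cmp (size l) k
... | tri≈ _ refl _ =
  mkSplitAt l r ε refl (λ v → inl v , refl) (λ v → inj₂ (inr v , refl))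
... | tri< l<k _ _ = ⊥-elim (¬straddle (rightChild-straddles k o l r l<k k<size))
... | tri> _ _ k<l =
  splitAt-rotate k o l r (split k o l k<l (λ (v , c) → ¬straddle (inl v , c)))

Flawless⇒¬Straddles : ∀ o t L' R' → Flawless o t (node L' R') → ¬ Straddles (size L') o t
Flawless⇒¬Straddles o t leaf       R' fl (v , o<a , a≤o+0 , _) =
  <⇒≱ o<a (subst (leftLeafFrom o t v ≤_) (+-identityʳ o) a≤o+0)
Flawless⇒¬Straddles o t (node _ _) R' fl (v , c) = fl v (inl here) c

Flawless⇒≤T : ∀ t' o t → size t ≡ size t' → Flawless o t t' → t ≤T t'
Flawless⇒≤T leaf        o leaf       _  _  = ε
Flawless⇒≤T (node L' R') o t size≡ fl
  with split (size L') o t (subst (size L' <_) (sym size≡) (s≤s (m≤m+n _ _)))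
                             (Flawless⇒¬Straddles o t L' R' fl)
... | mkSplitAt X R t≤XR size-X X-spans R-spans =
  t≤XR ◅◅ ≤T-nodeˡ R (Flawless⇒≤T L' o X size-X X-flawless)
       ◅◅ ≤T-nodeʳ L' (Flawless⇒≤T R' (o + suc (size L')) R size-R R-flawless)
  where
  size-R : size R ≡ size R'
  size-R = +-cancelˡ-≡ (size L') _ _ (suc-injective (begin
    suc (size L' + size R) ≡⟨ cong (λ s → suc (s + size R)) (sym size-X) ⟩
    size (node X R)        ≡⟨ sym (≤T-size t≤XR) ⟩
    size t                 ≡⟨ size≡ ⟩
    size (node L' R')      ∎))
    where open ≡-Reasoning

  X-flawless : Flawless o X L'
  X-flawless v v' c with X-spans v
  ... | w , e = fl w (inl v') (Crossing-≡ (span o L' v') (sym e) c)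

  R-flawless : Flawless (o + suc (size L')) R R'
  R-flawless v v' c with R-spans v
  ... | inj₁ e       = ¬Crossing-offset _ b R' v' (Crossing-≡ (span _ R' v') (cong (_, b) e) c)
    where b = rightLeafFrom (o + suc (size L')) R v
  ... | inj₂ (w , e) = fl w (inr v') (Crossing-≡ (span _ R' v') (sym e) c)

lemma2p12 : (n : ℕ) (T T' : 𝒯 n) →
    (proj₁ T ≤T proj₁ T') ⇔ (¬ FlawedPair (proj₁ T) (proj₁ T'))
lemma2p12 n (T , size-T) (T' , size-T') = mk⇔
  (λ T≤T' (v , v' , c) → ≤T⇒Flawless 0 T≤T' v v' c)
  (λ noFlaw → Flawless⇒≤T T' 0 T (trans size-T (sym size-T')) (λ v v' c → noFlaw (v , v' , c)))
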